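{- Every finite complete graph is perm-complete.
   Context: A simple graph on vertex set $n=\{0,\ldots,n-1\}$ is perm-complete iff the sequence $\mathbf s$ listing each of its edges $(x\,y)$ exactly once as the transposition $(x\,y)\in\mathrm{Sym}(n)$ satisfies $\mathrm{Prod}(\mathbf s)\in\{\mathrm{Alt}(n),\mathrm{Sym}(n)\setminus\mathrm{Alt}(n)\}$, where $\mathrm{Prod}(\mathbf s)$ is the set of products (composed left to right) of all rearrangements of $\mathbf s$. -}

module Defs where

open import Data.Nat using (ℕ; _%_)
open import Data.Fin using (Fin; toℕ; _<?_)
open import Data.Fin.Permutation using (Permutation′; _⟨$⟩ʳ_; _∘ₚ_; id; transpose; _≈_)
open import Data.List using (List; []; _∷_; filter; concatMap; map; length; allFin)
open import Data.List.Relation.Binary.Permutation.Propositional using (_↭_)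
open import Data.Product using (_×_; _,_; proj₁; proj₂; ∃-syntax)
open import Relation.Binary.PropositionalEquality using (_≡_)

orderedPairs : (n : ℕ) → List (Fin n × Fin n)
orderedPairs n = filter (λ p → proj₁ p <? proj₂ p)
                   (concatMap (λ i → map (λ j → (i , j)) (allFin n)) (allFin n))

-- Edge list of the complete graph K_n on vertex set {0,…,n-1}: each edge {x,y}
-- listed exactly once, as (x , y) with x < y.
completeGraphEdges : (n : ℕ) → List (Fin n × Fin n)
completeGraphEdges = orderedPairs

-- Product of a sequence of edges, each read as the transposition (x y),
-- composed left to right: the first transposition is applied first
-- (π₁ ∘ₚ π₂ applies π₁ first, then π₂).
prod : {n : ℕ} → List (Fin n × Fin n) → Permutation′ n
prod []             = id
prod ((x , y) ∷ s)  = transpose x y ∘ₚ prod s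

InProd : {n : ℕ} → List (Fin n × Fin n) → Permutation′ n → Set
InProd s π = ∃[ s′ ] ((s′ ↭ s) × (prod s′ ≈ π))

inversions : {n : ℕ} → Permutation′ n → ℕ
inversions {n} π = length (filter (λ p → (π ⟨$⟩ʳ proj₂ p) <? (π ⟨$⟩ʳ proj₁ p)) (orderedPairs n))

IsEven : {n : ℕ} → Permutation′ n → Set
IsEven π = inversions π % 2 ≡ 0

module Submission where

-- Soundness is the classical fact that composing with a transposition flips
-- the inversion parity; it is proved for injective functions Fin n → Fin m by
-- recursion on n, using the first-row decomposition of the inversion count.
--
-- Completeness is proved by induction on n.  The edges of K_{n+1} are the
-- spokes (0, j+1) together with a shifted copy of K_n.  If π moves some
-- vertex, the spokes can be split into a prefix and a suffix so that what
-- remains in the middle fixes 0, i.e. is a lifted permutation of n points,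
-- which K_n realizes by induction (sandwich, peel-vertex).  The identity is
-- realized through an explicit ordering of the edges at vertices 0 and 1
-- that leaves a doubly lifted permutation for K_{n-2} (identity-realized).

open import Defs
open import Data.Nat using (ℕ)
open import Data.Sum using (_⊎_)
open import Data.Fin.Permutation using (Permutation′)
open import Relation.Nullary using (¬_)
open import Function.Bundles using (_⇔_)

import Algebra.Solver.CommutativeMonoid as CommutativeMonoidSolver
open import Data.Bool.Base using (true; false; if_then_else_)
open import Data.Empty using (⊥-elim)
open import Data.Nat.Base using (zero; suc; z<s; parity; _%_) renaming (_+_ to _+ℕ_)
open import Data.Fin using (Fin; zero; suc; _<_; _<?_)
open import Data.Fin.Patterns using (0F; 1F; 2F; 3F)
open import Data.Fin.Properties using (_≟_; <-cmp; <-asym; <⇒≢; suc-injective; any?)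
open import Data.Fin.Permutation
  using (_⟨$⟩ʳ_; _⟨$⟩ˡ_; _∘ₚ_; id; flip; transpose; _≈_; lift₀; remove; inverseˡ; inverseʳ;
         lift₀-id; lift₀-cong; lift₀-remove; lift₀-transpose)
import Data.Fin.Permutation.Components as PC
open import Data.List.Base
  using (List; []; _∷_; [_]; _++_; map; concat; concatMap; filter; length; allFin; tabulate)
open import Data.List.Properties
  using (filter-++; filter-all; length-++; length-map; map-++; map-concatMap; map-tabulate;
         tabulate-cong)
open import Data.List.Membership.Propositional using (_∈_)
open import Data.List.Membership.Propositional.Properties using (∈-∃++; ∈-allFin)
open import Data.List.Relation.Unary.All using (All; []; _∷_)
import Data.List.Relation.Unary.All as All
open import Data.List.Relation.Unary.All.Properties using (all-filter; map⁺; ++⁺; tabulate⁺)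
open import Data.List.Relation.Unary.AllPairs using (_∷_)
open import Data.List.Relation.Unary.Any using (here; there)
open import Data.List.Relation.Unary.Unique.Propositional using (Unique)
open import Data.List.Relation.Unary.Unique.Propositional.Properties using (allFin⁺)
open import Data.List.Relation.Binary.Permutation.Propositional
  using (_↭_; ↭-refl; ↭-sym; ↭-trans; ↭-prep; ↭-reflexive; ↭⇒↭ₛ)
open import Data.List.Relation.Binary.Permutation.Propositional.Properties
  using (shift; zoom; ↭-length; All-resp-↭; ∈-resp-↭; ++-commutativeMonoid)
import Data.List.Relation.Binary.Permutation.Propositional.Properties as ↭
import Data.List.Relation.Binary.Permutation.Setoid.Properties as ↭ₛ
open import Data.Parity.Base using (Parity; 0ℙ; 1ℙ; _+_)
import Data.Parity.Properties as ℙ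
open import Algebra.Properties.CommutativeMonoid.Sum ℙ.+-0-commutativeMonoid
  using (sum; sum-permute; sum-cong-≗; sum-replicate-zero)
open import Algebra.Properties.CommutativeSemigroup ℙ.+-commutativeSemigroup
  using (x∙yz≈y∙xz; xy∙z≈y∙xz)
open import Data.Product.Base using (_×_; _,_; proj₁; proj₂; ∃-syntax)
open import Data.Sum.Base using (inj₁; inj₂)
open import Function.Base using (_∘_)
open import Function.Bundles using (mk⇔)
open import Function.Construct.Composition using (_⇔-∘_)
open import Function.Definitions using (Injective)
open import Relation.Binary.Definitions using (tri<; tri≈; tri>)
open import Relation.Nullary using (yes; no; ¬?)
open import Relation.Nullary.Decidable using (Dec; does; dec-true; dec-false; toSum)
open import Relation.Unary using (Pred; Decidable)
open import Relation.Binary.PropositionalEquality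
  using (_≡_; _≢_; refl; sym; trans; cong; cong₂; setoid; module ≡-Reasoning)

Edge : ℕ → Set
Edge n = Fin n × Fin n

⇑ : ∀ {n} → Edge n → Edge (suc n)
⇑ e = suc (proj₁ e) , suc (proj₂ e)

spoke : ∀ {n} → Fin n → Edge (suc n)
spoke j = zero , suc j

spokes : ∀ n → List (Edge (suc n))
spokes n = tabulate spoke

Ordered : ∀ {n} → Edge n → Set
Ordered e = proj₁ e < proj₂ e

Proper : ∀ {n} → Edge n → Set
Proper e = proj₁ e ≢ proj₂ e

row : ∀ {n} → Fin n → List (Edge n)
row {n} i = map (i ,_) (allFin n)

module _ {a b p q} {A : Set a} {B : Set b} {P : Pred B p} {Q : Pred A q} where

  filter-map : (P? : Decidable P) (Q? : Decidable Q) (g : A → B) →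
    (∀ x → does (P? (g x)) ≡ does (Q? x)) →
    ∀ xs → filter P? (map g xs) ≡ map g (filter Q? xs)
  filter-map P? Q? g same [] = refl
  filter-map P? Q? g same (x ∷ xs) rewrite same x with does (Q? x)
  ... | true  = cong (g x ∷_) (filter-map P? Q? g same xs)
  ... | false = filter-map P? Q? g same xs

module _ {a b p} {A : Set a} {B : Set b} {P : Pred B p} (P? : Decidable P) where

  filter-concatMap : ∀ (f : A → List B) xs →
    filter P? (concatMap f xs) ≡ concatMap (filter P? ∘ f) xs
  filter-concatMap f []       = refl
  filter-concatMap f (x ∷ xs) =
    trans (filter-++ P? (f x) (concatMap f xs)) (cong (filter P? (f x) ++_) (filter-concatMap f xs))

ordered? : ∀ {n} → Decidable (Ordered {n})
ordered? e = proj₁ e <? proj₂ e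

filter-ordered-⇑ : ∀ {n} (es : List (Edge n)) →
  filter ordered? (map ⇑ es) ≡ map ⇑ (filter ordered? es)
filter-ordered-⇑ = filter-map ordered? ordered? ⇑ (λ _ → refl)

row-suc : ∀ {n} (i : Fin n) → row (suc i) ≡ (suc i , zero) ∷ map ⇑ (row i)
row-suc {n} i = cong ((suc i , zero) ∷_) (begin
    map (suc i ,_) (tabulate suc)     ≡⟨ map-tabulate suc (suc i ,_) ⟩
    tabulate (λ j → suc i , suc j)    ≡⟨ sym (map-tabulate (i ,_) ⇑) ⟩
    map ⇑ (tabulate (i ,_))           ≡⟨ cong (map ⇑) (sym (map-tabulate (λ j → j) (i ,_))) ⟩
    map ⇑ (row i)                     ∎)
  where open ≡-Reasoning

row-zero : ∀ {n} → row {suc n} zero ≡ (zero , zero) ∷ spokes n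
row-zero = cong ((zero , zero) ∷_) (map-tabulate suc (zero ,_))

orderedPairs-suc : ∀ n → orderedPairs (suc n) ≡ spokes n ++ map ⇑ (orderedPairs n)
orderedPairs-suc n = begin
    filter ordered? (concatMap row (allFin (suc n)))
  ≡⟨ filter-concatMap ordered? row (allFin (suc n)) ⟩
    concatMap (filter ordered? ∘ row) (allFin (suc n))
  ≡⟨ cong₂ _++_ first rest ⟩
    spokes n ++ map ⇑ (orderedPairs n)
  ∎
  where
  open ≡-Reasoning
  first : filter ordered? (row {suc n} zero) ≡ spokes n
  first = trans (cong (filter ordered?) row-zero)
                (filter-all ordered? (tabulate⁺ (λ _ → z<s)))
  rest : concatMap (filter ordered? ∘ row) (tabulate {n = n} suc) ≡ map ⇑ (orderedPairs n)
  rest = begin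
      concatMap (filter ordered? ∘ row) (tabulate suc)
    ≡⟨ cong concat (map-tabulate suc (filter ordered? ∘ row)) ⟩
      concat (tabulate (filter ordered? ∘ row ∘ suc))
    ≡⟨ cong concat (tabulate-cong (λ i → cong (filter ordered?) (row-suc i))) ⟩
      concat (tabulate (filter ordered? ∘ map ⇑ ∘ row))
    ≡⟨ cong concat (tabulate-cong (λ i → filter-ordered-⇑ (row i))) ⟩
      concat (tabulate (map ⇑ ∘ filter ordered? ∘ row))
    ≡⟨ cong concat (sym (map-tabulate (λ i → i) (map ⇑ ∘ filter ordered? ∘ row))) ⟩
      concatMap (map ⇑ ∘ filter ordered? ∘ row) (allFin n)
    ≡⟨ sym (map-concatMap ⇑ (filter ordered? ∘ row) (allFin n)) ⟩
      map ⇑ (concatMap (filter ordered? ∘ row) (allFin n))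
    ≡⟨ cong (map ⇑) (sym (filter-concatMap ordered? row (allFin n))) ⟩
      map ⇑ (orderedPairs n)
    ∎

proper-orderedPairs : ∀ n → All Proper (orderedPairs n)
proper-orderedPairs n = All.map <⇒≢ (all-filter ordered? (concatMap row (allFin n)))

τ : ∀ {n} → Fin n → Fin n → Fin n → Fin n
τ = PC.transpose

τ-left : ∀ {n} (a b : Fin n) → τ a b a ≡ b
τ-left a b rewrite dec-true (a ≟ a) refl = refl

τ-right : ∀ {n} (a b : Fin n) → τ a b b ≡ a
τ-right a b with b ≟ a
... | yes refl = refl
... | no _ rewrite dec-true (b ≟ b) refl = refl

τ-other : ∀ {n} {a b k : Fin n} → k ≢ a → k ≢ b → τ a b k ≡ k
τ-other {a = a} {b} {k} k≢a k≢b rewrite dec-false (k ≟ a) k≢a | dec-false (k ≟ b) k≢b = refl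

τ-comm : ∀ {n} (a b k : Fin n) → τ a b k ≡ τ b a k
τ-comm a b k with toSum (k ≟ a) | toSum (k ≟ b)
... | inj₁ refl | _        = trans (τ-left k b) (sym (τ-right b k))
... | inj₂ k≢a  | inj₁ refl = trans (τ-right a k) (sym (τ-left k a))
... | inj₂ k≢a  | inj₂ k≢b  = trans (τ-other k≢a k≢b) (sym (τ-other k≢b k≢a))

τ-suc : ∀ {n} (a b k : Fin n) → τ (suc a) (suc b) (suc k) ≡ suc (τ a b k)
τ-suc a b k = lift₀-transpose a b (suc k)

τ-conj : ∀ {n} (ρ : Permutation′ n) (a b i : Fin n) →
  τ a b (ρ ⟨$⟩ʳ i) ≡ ρ ⟨$⟩ʳ τ (ρ ⟨$⟩ˡ a) (ρ ⟨$⟩ˡ b) i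
τ-conj ρ a b i with toSum (i ≟ ρ ⟨$⟩ˡ a) | toSum (i ≟ ρ ⟨$⟩ˡ b)
... | inj₁ refl | _ = begin
    τ a b (ρ ⟨$⟩ʳ (ρ ⟨$⟩ˡ a))   ≡⟨ cong (τ a b) (inverseʳ ρ) ⟩
    τ a b a                      ≡⟨ τ-left a b ⟩
    b                            ≡⟨ inverseʳ ρ ⟨
    ρ ⟨$⟩ʳ (ρ ⟨$⟩ˡ b)            ≡⟨ cong (ρ ⟨$⟩ʳ_) (τ-left (ρ ⟨$⟩ˡ a) (ρ ⟨$⟩ˡ b)) ⟨
    ρ ⟨$⟩ʳ τ (ρ ⟨$⟩ˡ a) (ρ ⟨$⟩ˡ b) (ρ ⟨$⟩ˡ a) ∎
  where open ≡-Reasoning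
... | inj₂ _ | inj₁ refl = begin
    τ a b (ρ ⟨$⟩ʳ (ρ ⟨$⟩ˡ b))   ≡⟨ cong (τ a b) (inverseʳ ρ) ⟩
    τ a b b                      ≡⟨ τ-right a b ⟩
    a                            ≡⟨ inverseʳ ρ ⟨
    ρ ⟨$⟩ʳ (ρ ⟨$⟩ˡ a)            ≡⟨ cong (ρ ⟨$⟩ʳ_) (τ-right (ρ ⟨$⟩ˡ a) (ρ ⟨$⟩ˡ b)) ⟨
    ρ ⟨$⟩ʳ τ (ρ ⟨$⟩ˡ a) (ρ ⟨$⟩ˡ b) (ρ ⟨$⟩ˡ b) ∎
  where open ≡-Reasoning
... | inj₂ i≢a′ | inj₂ i≢b′ =
  trans (τ-other (i≢a′ ∘ moved) (i≢b′ ∘ moved)) (cong (ρ ⟨$⟩ʳ_) (sym (τ-other i≢a′ i≢b′)))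
  where
  moved : ∀ {x} → ρ ⟨$⟩ʳ i ≡ x → i ≡ ρ ⟨$⟩ˡ x
  moved refl = sym (inverseˡ ρ)

⟦_⟧ : ∀ {p} {P : Set p} → Dec P → Parity
⟦ d ⟧ = if does d then 1ℙ else 0ℙ

inverted : ∀ {m} → Fin m → Fin m → Parity
inverted x y = ⟦ y <? x ⟧

inversionParity : ∀ {n m} → (Fin n → Fin m) → Parity
inversionParity {zero}  f = 0ℙ
inversionParity {suc n} f = sum (λ j → inverted (f zero) (f (suc j))) + inversionParity (f ∘ suc)

parity-suc : ∀ n → parity (suc n) ≡ 1ℙ + parity n
parity-suc n = ℙ.+-homo-+ 1 n

parity-count : ∀ {a p n} {A : Set a} {P : Pred A p} (P? : Decidable P) (g : Fin n → A) →
  parity (length (filter P? (tabulate g))) ≡ sum (λ j → ⟦ P? (g j) ⟧)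
parity-count {n = zero}  P? g = refl
parity-count {n = suc n} P? g with does (P? (g zero))
... | true  = trans (parity-suc (length (filter P? (tabulate (g ∘ suc)))))
                    (cong (1ℙ +_) (parity-count P? (g ∘ suc)))
... | false = parity-count P? (g ∘ suc)

inversions-parity : ∀ n {m} (f : Fin n → Fin m) →
  parity (length (filter (λ e → f (proj₂ e) <? f (proj₁ e)) (orderedPairs n))) ≡ inversionParity f
inversions-parity zero    f = refl
inversions-parity (suc n) f = begin
    parity (length (filter inv? (orderedPairs (suc n))))
  ≡⟨ cong (λ es → parity (length (filter inv? es))) (orderedPairs-suc n) ⟩
    parity (length (filter inv? (spokes n ++ map ⇑ (orderedPairs n))))
  ≡⟨ cong (parity ∘ length) (filter-++ inv? (spokes n) _) ⟩
    parity (length (filter inv? (spokes n) ++ filter inv? (map ⇑ (orderedPairs n))))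
  ≡⟨ cong parity (length-++ (filter inv? (spokes n))) ⟩
    parity (length (filter inv? (spokes n)) +ℕ length (filter inv? (map ⇑ (orderedPairs n))))
  ≡⟨ ℙ.+-homo-+ (length (filter inv? (spokes n))) _ ⟩
    parity (length (filter inv? (spokes n))) + parity (length (filter inv? (map ⇑ (orderedPairs n))))
  ≡⟨ cong₂ _+_ (parity-count inv? spoke) tail ⟩
    inversionParity f
  ∎
  where
  open ≡-Reasoning
  inv? = λ (e : Edge (suc n)) → f (proj₂ e) <? f (proj₁ e)
  inv∘suc? = λ (e : Edge n) → f (suc (proj₂ e)) <? f (suc (proj₁ e))
  tail : parity (length (filter inv? (map ⇑ (orderedPairs n)))) ≡ inversionParity (f ∘ suc)
  tail = begin
      parity (length (filter inv? (map ⇑ (orderedPairs n))))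
    ≡⟨ cong (parity ∘ length) (filter-map inv? inv∘suc? ⇑ (λ _ → refl) (orderedPairs n)) ⟩
      parity (length (map ⇑ (filter inv∘suc? (orderedPairs n))))
    ≡⟨ cong parity (length-map ⇑ (filter inv∘suc? (orderedPairs n))) ⟩
      parity (length (filter inv∘suc? (orderedPairs n)))
    ≡⟨ inversions-parity n (f ∘ suc) ⟩
      inversionParity (f ∘ suc)
    ∎

inversionParity-cong : ∀ {n m} {f g : Fin n → Fin m} → (∀ i → f i ≡ g i) →
  inversionParity f ≡ inversionParity g
inversionParity-cong {zero}  f≗g = refl
inversionParity-cong {suc n} f≗g = cong₂ _+_
  (sum-cong-≗ (λ j → cong₂ inverted (f≗g zero) (f≗g (suc j)))) (inversionParity-cong (f≗g ∘ suc))

inverted-flip : ∀ {m} {x y : Fin m} → x ≢ y → inverted y x ≡ 1ℙ + inverted x y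
inverted-flip {x = x} {y} x≢y with <-cmp x y
... | tri< x<y _ _ rewrite dec-true (x <? y) x<y | dec-false (y <? x) (<-asym x<y) = refl
... | tri≈ _ x≡y _ = ⊥-elim (x≢y x≡y)
... | tri> _ _ y<x rewrite dec-true (y <? x) y<x | dec-false (x <? y) (<-asym y<x) = refl

-- Swapping the first two positions flips the inversion parity: the two first-row
-- sums trade places and only the comparison of f 0 with f 1 changes.
swap-01 : ∀ {k m} (f : Fin (suc (suc k)) → Fin m) → f zero ≢ f (suc zero) →
  inversionParity (f ∘ τ zero (suc zero)) ≡ 1ℙ + inversionParity f
swap-01 {k} f f₀≢f₁ = begin
    (inverted (f (suc zero)) (f zero) + B) + (A + I)
  ≡⟨ cong (λ x → (x + B) + (A + I)) (inverted-flip f₀≢f₁) ⟩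
    ((1ℙ + inverted (f zero) (f (suc zero))) + B) + (A + I)
  ≡⟨ solve 5 (λ o x a b i → ((o ⊕ x) ⊕ b) ⊕ (a ⊕ i) ⊜ o ⊕ ((x ⊕ a) ⊕ (b ⊕ i)))
             refl 1ℙ (inverted (f zero) (f (suc zero))) A B I ⟩
    1ℙ + ((inverted (f zero) (f (suc zero)) + A) + (B + I))
  ∎
  where
  open ≡-Reasoning
  open CommutativeMonoidSolver ℙ.+-0-commutativeMonoid using (solve; _⊕_; _⊜_)
  A = sum (λ j → inverted (f zero) (f (suc (suc j))))
  B = sum (λ j → inverted (f (suc zero)) (f (suc (suc j))))
  I = inversionParity (λ (j : Fin k) → f (suc (suc j)))

-- Swapping two positions of the tail leaves the first-row sum unchanged (it is a
-- sum over the tail, which is merely permuted), so the flip comes from the tail.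
swap-tail : ∀ {n m} (f : Fin (suc n) → Fin m) (a b : Fin n) →
  inversionParity (f ∘ suc ∘ τ a b) ≡ 1ℙ + inversionParity (f ∘ suc) →
  inversionParity (f ∘ τ (suc a) (suc b)) ≡ 1ℙ + inversionParity f
swap-tail {n} f a b flipped = begin
    sum (λ j → inverted (f zero) (f (τ (suc a) (suc b) (suc j))))
      + inversionParity (f ∘ τ (suc a) (suc b) ∘ suc)
  ≡⟨ cong₂ _+_ (sum-cong-≗ (λ j → cong (inverted (f zero) ∘ f) (τ-suc a b j)))
               (inversionParity-cong (λ j → cong f (τ-suc a b j))) ⟩
    sum (firstRow ∘ τ a b) + inversionParity (f ∘ suc ∘ τ a b)
  ≡⟨ cong₂ _+_ (sym (sum-permute firstRow (transpose a b))) flipped ⟩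
    sum firstRow + (1ℙ + inversionParity (f ∘ suc))
  ≡⟨ x∙yz≈y∙xz (sum firstRow) 1ℙ _ ⟩
    1ℙ + inversionParity f
  ∎
  where
  open ≡-Reasoning
  firstRow : Fin n → Parity
  firstRow j = inverted (f zero) (f (suc j))

∘τ-injective : ∀ {n m} {f : Fin n → Fin m} → Injective _≡_ _≡_ f →
  ∀ a b → Injective _≡_ _≡_ (f ∘ τ a b)
∘τ-injective inj a b {i} {j} e =
  trans (sym (inverseˡ (transpose a b))) (trans (cong (τ b a) (inj e)) (inverseˡ (transpose a b)))

∘suc-injective : ∀ {n m} {f : Fin (suc n) → Fin m} → Injective _≡_ _≡_ f →
  Injective _≡_ _≡_ (f ∘ suc)
∘suc-injective inj = suc-injective ∘ inj

inversionParity-swap : ∀ {n m} (f : Fin n → Fin m) → Injective _≡_ _≡_ f → ∀ {a b} → a ≢ b →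
  inversionParity (f ∘ τ a b) ≡ 1ℙ + inversionParity f
inversionParity-swap {suc n} {m} f inj {a} {b} = swap a b
  where
  from-zero : ∀ b → inversionParity (f ∘ τ zero (suc b)) ≡ 1ℙ + inversionParity f
  from-zero zero = swap-01 f (λ e → 0≢1 (inj e))
    where
    0≢1 : zero ≢ suc zero
    0≢1 ()
  -- (0 c+2) is the conjugate (c+2 1) ∘ (0 1) ∘ (1 c+2): two swaps inside the tail
  -- around one swap of the first two positions, three flips in total.
  from-zero (suc c) = begin
      inversionParity (f ∘ τ zero (suc (suc c)))
    ≡⟨ inversionParity-cong (cong f ∘ conjugated) ⟩
      inversionParity (g₂ ∘ u)
    ≡⟨ swap-tail g₂ zero (suc c)
         (inversionParity-swap (g₂ ∘ suc) (∘suc-injective g₂-injective) {zero} {suc c} (λ ())) ⟩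
      1ℙ + inversionParity g₂
    ≡⟨ cong (1ℙ +_) (swap-01 g₁ (λ e → 0≢c+2 (inj e))) ⟩
      1ℙ + (1ℙ + inversionParity g₁)
    ≡⟨ ℙ.⁻¹-involutive (inversionParity g₁) ⟩
      inversionParity g₁
    ≡⟨ swap-tail f (suc c) zero
         (inversionParity-swap (f ∘ suc) (∘suc-injective inj) {suc c} {zero} (λ ())) ⟩
      1ℙ + inversionParity f
    ∎
    where
    open ≡-Reasoning
    t u : Fin (suc n) → Fin (suc n)
    t = τ (suc (suc c)) (suc zero)
    u = τ (suc zero) (suc (suc c))
    g₁ g₂ : Fin (suc n) → Fin m
    g₁ = f ∘ t
    g₂ = g₁ ∘ τ zero (suc zero)
    g₂-injective : Injective _≡_ _≡_ g₂
    g₂-injective = ∘τ-injective (∘τ-injective inj (suc (suc c)) (suc zero)) zero (suc zero)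
    0≢c+2 : zero ≢ suc (suc c)
    0≢c+2 ()
    conjugated : ∀ i → τ zero (suc (suc c)) i ≡ t (τ zero (suc zero) (u i))
    conjugated i = trans (sym (inverseˡ ρ)) (cong t (sym (τ-conj ρ zero (suc zero) i)))
      where
      ρ : Permutation′ (suc n)
      ρ = transpose (suc zero) (suc (suc c))
  swap : ∀ a b → a ≢ b → inversionParity (f ∘ τ a b) ≡ 1ℙ + inversionParity f
  swap zero    zero    a≢b = ⊥-elim (a≢b refl)
  swap zero    (suc b) _   = from-zero b
  swap (suc a) zero    _   =
    trans (inversionParity-cong (cong f ∘ τ-comm (suc a) zero)) (from-zero a)
  swap (suc a) (suc b) a≢b =
    swap-tail f a b (inversionParity-swap (f ∘ suc) (∘suc-injective inj) (a≢b ∘ cong suc))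

sgn : ∀ {n} → Permutation′ n → Parity
sgn π = parity (inversions π)

sgn≡inversionParity : ∀ {n} (π : Permutation′ n) → sgn π ≡ inversionParity (π ⟨$⟩ʳ_)
sgn≡inversionParity {n} π = inversions-parity n (π ⟨$⟩ʳ_)

sgn-cong : ∀ {n} {π ρ : Permutation′ n} → π ≈ ρ → sgn π ≡ sgn ρ
sgn-cong {π = π} {ρ} π≈ρ =
  trans (sgn≡inversionParity π) (trans (inversionParity-cong π≈ρ) (sym (sgn≡inversionParity ρ)))

permute-injective : ∀ {n} (π : Permutation′ n) → Injective _≡_ _≡_ (π ⟨$⟩ʳ_)
permute-injective π {i} {j} e = trans (sym (inverseˡ π)) (trans (cong (π ⟨$⟩ˡ_) e) (inverseˡ π))

sgn-transpose-∘ : ∀ {n} {a b : Fin n} (ρ : Permutation′ n) → a ≢ b →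
  sgn (transpose a b ∘ₚ ρ) ≡ 1ℙ + sgn ρ
sgn-transpose-∘ {a = a} {b} ρ a≢b = begin
    sgn (transpose a b ∘ₚ ρ)              ≡⟨ sgn≡inversionParity (transpose a b ∘ₚ ρ) ⟩
    inversionParity ((ρ ⟨$⟩ʳ_) ∘ τ a b)   ≡⟨ inversionParity-swap (ρ ⟨$⟩ʳ_) (permute-injective ρ) a≢b ⟩
    1ℙ + inversionParity (ρ ⟨$⟩ʳ_)        ≡⟨ cong (1ℙ +_) (sgn≡inversionParity ρ) ⟨
    1ℙ + sgn ρ                            ∎
  where open ≡-Reasoning

-- Postcomposing with a transposition flips the sign: conjugate it to the front.
sgn-∘-transpose : ∀ {n} {a b : Fin n} (ρ : Permutation′ n) → a ≢ b →
  sgn (ρ ∘ₚ transpose a b) ≡ 1ℙ + sgn ρ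
sgn-∘-transpose {a = a} {b} ρ a≢b = trans
  (sgn-cong {π = ρ ∘ₚ transpose a b} {transpose (ρ ⟨$⟩ˡ a) (ρ ⟨$⟩ˡ b) ∘ₚ ρ} (τ-conj ρ a b))
  (sgn-transpose-∘ ρ (a≢b ∘ ρ⁻¹-injective))
  where
  ρ⁻¹-injective : ρ ⟨$⟩ˡ a ≡ ρ ⟨$⟩ˡ b → a ≡ b
  ρ⁻¹-injective e = trans (sym (inverseʳ ρ)) (trans (cong (ρ ⟨$⟩ʳ_) e) (inverseʳ ρ))

inversionParity-suc∘ : ∀ {n m} (g : Fin n → Fin m) →
  inversionParity (λ i → suc (g i)) ≡ inversionParity g
inversionParity-suc∘ {zero}  g = refl
inversionParity-suc∘ {suc n} g =
  cong (sum (λ j → inverted (g zero) (g (suc j))) +_) (inversionParity-suc∘ (g ∘ suc))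

sgn-lift₀ : ∀ {n} (π : Permutation′ n) → sgn (lift₀ π) ≡ sgn π
sgn-lift₀ {n} π = begin
    sgn (lift₀ π)
  ≡⟨ sgn≡inversionParity (lift₀ π) ⟩
    sum {n} (λ _ → 0ℙ) + inversionParity (λ i → suc (π ⟨$⟩ʳ i))
  ≡⟨ cong₂ _+_ (sum-replicate-zero n) (inversionParity-suc∘ (π ⟨$⟩ʳ_)) ⟩
    inversionParity (π ⟨$⟩ʳ_)
  ≡⟨ sgn≡inversionParity π ⟨
    sgn π
  ∎
  where open ≡-Reasoning

sgn-id : ∀ {n} → sgn (id {n}) ≡ 0ℙ
sgn-id {zero}  = refl
sgn-id {suc n} = trans (sgn-cong {π = id} {lift₀ (id {n})} (λ i → sym (lift₀-id i)))
                       (trans (sgn-lift₀ (id {n})) (sgn-id {n}))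

sgn-prod-∘ : ∀ {n} (s : List (Edge n)) (ρ : Permutation′ n) → All Proper s →
  sgn (prod s ∘ₚ ρ) ≡ parity (length s) + sgn ρ
sgn-prod-∘ []            ρ []           = refl
sgn-prod-∘ ((a , b) ∷ s) ρ (a≢b ∷ ps) = begin
    sgn (transpose a b ∘ₚ prod s ∘ₚ ρ)
  ≡⟨ sgn-transpose-∘ (prod s ∘ₚ ρ) a≢b ⟩
    1ℙ + sgn (prod s ∘ₚ ρ)
  ≡⟨ cong (1ℙ +_) (sgn-prod-∘ s ρ ps) ⟩
    1ℙ + (parity (length s) + sgn ρ)
  ≡⟨ ℙ.+-assoc 1ℙ (parity (length s)) (sgn ρ) ⟨
    (1ℙ + parity (length s)) + sgn ρ
  ≡⟨ cong (_+ sgn ρ) (parity-suc (length s)) ⟨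
    parity (suc (length s)) + sgn ρ
  ∎
  where open ≡-Reasoning

sgn-∘-prod : ∀ {n} (ρ : Permutation′ n) (s : List (Edge n)) → All Proper s →
  sgn (ρ ∘ₚ prod s) ≡ sgn ρ + parity (length s)
sgn-∘-prod ρ []            []           = sym (ℙ.+-identityʳ (sgn ρ))
sgn-∘-prod ρ ((a , b) ∷ s) (a≢b ∷ ps) = begin
    sgn ((ρ ∘ₚ transpose a b) ∘ₚ prod s)
  ≡⟨ sgn-∘-prod (ρ ∘ₚ transpose a b) s ps ⟩
    sgn (ρ ∘ₚ transpose a b) + parity (length s)
  ≡⟨ cong (_+ parity (length s)) (sgn-∘-transpose ρ a≢b) ⟩
    (1ℙ + sgn ρ) + parity (length s)
  ≡⟨ xy∙z≈y∙xz 1ℙ (sgn ρ) (parity (length s)) ⟩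
    sgn ρ + (1ℙ + parity (length s))
  ≡⟨ cong (sgn ρ +_) (parity-suc (length s)) ⟨
    sgn ρ + parity (suc (length s))
  ∎
  where open ≡-Reasoning

sgn-prod : ∀ {n} (s : List (Edge n)) → All Proper s → sgn (prod s) ≡ parity (length s)
sgn-prod {n} s ps = trans (sgn-∘-prod id s ps) (cong (_+ parity (length s)) (sgn-id {n}))

sgn-sandwich : ∀ {n} (l₁ l₂ : List (Edge n)) (Λ : Permutation′ n) →
  All Proper l₁ → All Proper l₂ →
  sgn (prod l₁ ∘ₚ Λ ∘ₚ prod l₂) ≡ parity (length l₁) + (sgn Λ + parity (length l₂))
sgn-sandwich l₁ l₂ Λ ps₁ ps₂ =
  trans (sgn-prod-∘ l₁ (Λ ∘ₚ prod l₂) ps₁) (cong (parity (length l₁) +_) (sgn-∘-prod Λ l₂ ps₂))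

prod-++ : ∀ {n} (xs ys : List (Edge n)) → prod (xs ++ ys) ≈ prod xs ∘ₚ prod ys
prod-++ []            ys i = refl
prod-++ ((a , b) ∷ xs) ys i = prod-++ xs ys (τ a b i)

prod-⇑ : ∀ {n} (s : List (Edge n)) → prod (map ⇑ s) ≈ lift₀ (prod s)
prod-⇑ []            zero    = refl
prod-⇑ []            (suc i) = refl
prod-⇑ ((a , b) ∷ s) zero    = prod-⇑ s zero
prod-⇑ ((a , b) ∷ s) (suc i) =
  trans (cong (prod (map ⇑ s) ⟨$⟩ʳ_) (τ-suc a b i)) (prod-⇑ s (suc (τ a b i)))

inProd-resp-≈ : ∀ {n} {s : List (Edge n)} {π ρ} → π ≈ ρ → InProd s π → InProd s ρ
inProd-resp-≈ π≈ρ (s′ , s′↭s , s′≈π) = s′ , s′↭s , λ i → trans (s′≈π i) (π≈ρ i)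

inProd-resp-↭ : ∀ {n} {s t : List (Edge n)} {π} → s ↭ t → InProd s π → InProd t π
inProd-resp-↭ s↭t (s′ , s′↭s , s′≈π) = s′ , ↭-trans s′↭s s↭t , s′≈π

inProd-⇑ : ∀ {n} {s : List (Edge n)} {π} → InProd s π → InProd (map ⇑ s) (lift₀ π)
inProd-⇑ {π = π} (s′ , s′↭s , s′≈π) =
  map ⇑ s′ , ↭.map⁺ ⇑ s′↭s , λ i → trans (prod-⇑ s′ i) (lift₀-cong (prod s′) π s′≈π i)

inProd-sandwich : ∀ {n} (l₁ l₂ : List (Edge n)) {M Λ} → InProd M Λ →
  InProd (l₁ ++ M ++ l₂) (prod l₁ ∘ₚ Λ ∘ₚ prod l₂)
inProd-sandwich l₁ l₂ {Λ = Λ} (s , s↭M , s≈Λ) = l₁ ++ s ++ l₂ , zoom l₁ s↭M , λ i → begin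
    prod (l₁ ++ s ++ l₂) ⟨$⟩ʳ i
  ≡⟨ prod-++ l₁ (s ++ l₂) i ⟩
    prod (s ++ l₂) ⟨$⟩ʳ (prod l₁ ⟨$⟩ʳ i)
  ≡⟨ prod-++ s l₂ (prod l₁ ⟨$⟩ʳ i) ⟩
    prod l₂ ⟨$⟩ʳ (prod s ⟨$⟩ʳ (prod l₁ ⟨$⟩ʳ i))
  ≡⟨ cong (prod l₂ ⟨$⟩ʳ_) (s≈Λ (prod l₁ ⟨$⟩ʳ i)) ⟩
    (prod l₁ ∘ₚ Λ ∘ₚ prod l₂) ⟨$⟩ʳ i
  ∎
  where open ≡-Reasoning

sgn-sound : ∀ {n} {E : List (Edge n)} {π} → All Proper E → InProd E π →
  sgn π ≡ parity (length E)
sgn-sound {E = E} {π} proper (s , s↭E , s≈π) = begin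
    sgn π               ≡⟨ sgn-cong {π = π} {prod s} (λ i → sym (s≈π i)) ⟩
    sgn (prod s)        ≡⟨ sgn-prod s (All-resp-↭ (↭-sym s↭E) proper) ⟩
    parity (length s)   ≡⟨ cong parity (↭-length s↭E) ⟩
    parity (length E)   ∎
  where open ≡-Reasoning

parity-length-++ : ∀ {a} {A : Set a} (xs ys : List A) →
  parity (length (xs ++ ys)) ≡ parity (length xs) + parity (length ys)
parity-length-++ xs ys = trans (cong parity (length-++ xs)) (ℙ.+-homo-+ (length xs) (length ys))

-- If the middle part c₁⁻¹ ∘ₚ π ∘ₚ c₂⁻¹ is
-- a permutation Λ that M realizes as soon as it has sign parity |M|, then E realizes π:
-- the parity condition on Λ is forced by the one on π.
sandwich : ∀ {n} {l₁ M l₂ E : List (Edge n)} {π Λ : Permutation′ n} →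
  All Proper l₁ → All Proper l₂ → l₁ ++ M ++ l₂ ↭ E →
  (sgn Λ ≡ parity (length M) → InProd M Λ) →
  flip (prod l₁) ∘ₚ π ∘ₚ flip (prod l₂) ≈ Λ →
  sgn π ≡ parity (length E) → InProd E π
sandwich {n} {l₁} {M} {l₂} {E} {π} {Λ} proper₁ proper₂ arrangement realize unwrapped even =
  inProd-resp-≈ {s = E} {c₁ ∘ₚ Λ ∘ₚ c₂} {π} rewrapped
    (inProd-resp-↭ {s = l₁ ++ M ++ l₂} {E} {c₁ ∘ₚ Λ ∘ₚ c₂} arrangement
      (inProd-sandwich l₁ l₂ {M} {Λ} (realize sgn-Λ)))
  where
  c₁ c₂ : Permutation′ n
  c₁ = prod l₁
  c₂ = prod l₂
  rewrapped : c₁ ∘ₚ Λ ∘ₚ c₂ ≈ π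
  rewrapped i = begin
      c₂ ⟨$⟩ʳ (Λ ⟨$⟩ʳ (c₁ ⟨$⟩ʳ i))
    ≡⟨ cong (c₂ ⟨$⟩ʳ_) (unwrapped (c₁ ⟨$⟩ʳ i)) ⟨
      c₂ ⟨$⟩ʳ (c₂ ⟨$⟩ˡ (π ⟨$⟩ʳ (c₁ ⟨$⟩ˡ (c₁ ⟨$⟩ʳ i))))
    ≡⟨ inverseʳ c₂ ⟩
      π ⟨$⟩ʳ (c₁ ⟨$⟩ˡ (c₁ ⟨$⟩ʳ i))
    ≡⟨ cong (π ⟨$⟩ʳ_) (inverseˡ c₁) ⟩
      π ⟨$⟩ʳ i
    ∎
    where open ≡-Reasoning
  p₁ p₂ : Parity
  p₁ = parity (length l₁)
  p₂ = parity (length l₂)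
  both-sides : p₁ + (sgn Λ + p₂) ≡ p₁ + (parity (length M) + p₂)
  both-sides = begin
      p₁ + (sgn Λ + p₂)                 ≡⟨ sgn-sandwich l₁ l₂ Λ proper₁ proper₂ ⟨
      sgn (c₁ ∘ₚ Λ ∘ₚ c₂)               ≡⟨ sgn-cong {π = c₁ ∘ₚ Λ ∘ₚ c₂} {π} rewrapped ⟩
      sgn π                             ≡⟨ even ⟩
      parity (length E)                 ≡⟨ cong parity (↭-length arrangement) ⟨
      parity (length (l₁ ++ M ++ l₂))   ≡⟨ parity-length-++ l₁ (M ++ l₂) ⟩
      p₁ + parity (length (M ++ l₂))    ≡⟨ cong (p₁ +_) (parity-length-++ M l₂) ⟩
      p₁ + (parity (length M) + p₂)     ∎
    where open ≡-Reasoning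
  sgn-Λ : sgn Λ ≡ parity (length M)
  sgn-Λ = ℙ.+-cancelʳ-≡ p₂ (sgn Λ) (parity (length M))
            (ℙ.+-cancelˡ-≡ p₁ (sgn Λ + p₂) (parity (length M) + p₂) both-sides)

Complete : ℕ → Set
Complete n = ∀ π → sgn π ≡ parity (length (orderedPairs n)) → InProd (orderedPairs n) π

lift-realize : ∀ {n} {K : List (Edge n)} {L : Permutation′ n} →
  (sgn L ≡ parity (length K) → InProd K L) →
  sgn (lift₀ L) ≡ parity (length (map ⇑ K)) → InProd (map ⇑ K) (lift₀ L)
lift-realize {K = K} {L} realize even =
  inProd-⇑ (realize (trans (sym (sgn-lift₀ L)) (trans even (cong parity (length-map ⇑ K)))))

Avoids : ∀ {n} → Fin n → Edge n → Set
Avoids u e = u ≢ proj₁ e × u ≢ proj₂ e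

prod-fixes : ∀ {n} {u : Fin n} (s : List (Edge n)) → All (Avoids u) s → prod s ⟨$⟩ʳ u ≡ u
prod-fixes []            []                  = refl
prod-fixes ((a , b) ∷ s) ((u≢a , u≢b) ∷ avs) =
  trans (cong (prod s ⟨$⟩ʳ_) (τ-other u≢a u≢b)) (prod-fixes s avs)

extract : ∀ {a} {A : Set a} {x : A} {xs} → x ∈ xs → Unique xs →
  ∃[ R ] (x ∷ R ↭ xs × All (x ≢_) R × Unique R)
extract {A = A} {x} x∈xs unique with ∈-∃++ x∈xs
... | ys , zs , refl with ↭ₛ.Unique-resp-↭ (setoid A) (↭⇒↭ₛ (shift x ys zs)) unique
...   | x∉ ∷ unique′ = ys ++ zs , ↭-sym (shift x ys zs) , x∉ , unique′

proper-spokes : ∀ {n} (s : List (Fin n)) → All Proper (map spoke s)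
proper-spokes s = map⁺ (All.universal (λ _ ()) s)

spokes-arrangement : ∀ {n} {s₁ s₂ : List (Fin n)} → s₁ ++ s₂ ↭ allFin n →
  map spoke s₁ ++ map spoke s₂ ↭ spokes n
spokes-arrangement {n} {s₁} {s₂} p = ↭-trans (↭-reflexive (sym (map-++ spoke s₁ s₂)))
  (↭-trans (↭.map⁺ spoke p) (↭-reflexive (map-tabulate (λ i → i) spoke)))

-- One step of the induction: order the spokes as s₁, then K_n, then w followed by the
-- rest R.  The suffix sends 0 to w + 1, so if π sends the point c₁⁻¹ 0 to w + 1 the
-- middle part fixes 0 and is a lifted permutation, realizable by induction.
peel-vertex : ∀ {n} → Complete n → (π : Permutation′ (suc n)) →
  sgn π ≡ parity (length (orderedPairs (suc n))) →
  (s₁ : List (Fin n)) (w : Fin n) (R : List (Fin n)) →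
  s₁ ++ w ∷ R ↭ allFin n → All (w ≢_) R →
  π ⟨$⟩ʳ (prod (map spoke s₁) ⟨$⟩ˡ zero) ≡ suc w → InProd (orderedPairs (suc n)) π
peel-vertex {n} complete π even s₁ w R s↭allFin w∉R π-target =
  sandwich {M = map ⇑ K} {π = π} {lift₀ L} (proper-spokes s₁) (proper-spokes (w ∷ R))
    arrangement (lift-realize (complete L)) unwrapped even
  where
  l₁ l₂ : List (Edge (suc n))
  l₁ = map spoke s₁
  l₂ = map spoke (w ∷ R)
  K : List (Edge n)
  K = orderedPairs n
  Λ : Permutation′ (suc n)
  Λ = flip (prod l₁) ∘ₚ π ∘ₚ flip (prod l₂)
  L : Permutation′ n
  L = remove zero Λ
  l₂-source : prod l₂ ⟨$⟩ʳ zero ≡ suc w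
  l₂-source = prod-fixes (map spoke R)
    (map⁺ (All.map (λ w≢j → (λ ()) , w≢j ∘ suc-injective) w∉R))
  Λ-fixes-0 : Λ ⟨$⟩ʳ zero ≡ zero
  Λ-fixes-0 = trans (cong (prod l₂ ⟨$⟩ˡ_) (trans π-target (sym l₂-source))) (inverseˡ (prod l₂))
  unwrapped : Λ ≈ lift₀ L
  unwrapped i = sym (lift₀-remove Λ Λ-fixes-0 i)
  open CommutativeMonoidSolver (++-commutativeMonoid {A = Edge (suc n)}) using (solve; _⊕_; _⊜_)
  arrangement : l₁ ++ map ⇑ K ++ l₂ ↭ orderedPairs (suc n)
  arrangement = ↭-trans (solve 3 (λ a m b → a ⊕ (m ⊕ b) ⊜ (a ⊕ b) ⊕ m) ↭-refl l₁ (map ⇑ K) l₂)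
    (↭-trans (↭.++⁺ʳ (map ⇑ K) (spokes-arrangement {s₁ = s₁} {w ∷ R} s↭allFin))
             (↭-reflexive (sym (orderedPairs-suc n))))

unlift₂ : ∀ {n} (Λ : Permutation′ (suc (suc n))) → Λ ⟨$⟩ʳ 0F ≡ 0F → Λ ⟨$⟩ʳ 1F ≡ 1F →
  Λ ≈ lift₀ (lift₀ (remove 0F (remove 0F Λ)))
unlift₂ {n} Λ fixes-0 fixes-1 i =
  sym (trans (lift₀-cong _ _ (lift₀-remove Λ₁ Λ₁-fixes-0) i) (lift₀-remove Λ fixes-0 i))
  where
  Λ₁ : Permutation′ (suc n)
  Λ₁ = remove 0F Λ
  Λ₁-fixes-0 : Λ₁ ⟨$⟩ʳ 0F ≡ 0F
  Λ₁-fixes-0 = suc-injective (trans (lift₀-remove Λ fixes-0 1F) fixes-1)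

-- Order the
-- edges as (0 1), the doubly shifted K_{2+q}, then (0 2) (1 3), the remaining edges at
-- 0 and 1, and (1 2) (0 3).  The outer blocks cancel on {0, 1}, so the middle part is a
-- doubly lifted permutation, realizable by induction.
identity-realized : ∀ q → Complete (suc (suc q)) →
  parity (length (orderedPairs (suc (suc (suc (suc q)))))) ≡ 0ℙ →
  InProd (orderedPairs (suc (suc (suc (suc q))))) id
identity-realized q complete even =
  sandwich {l₁ = l₁} {M} {l₂} {π = id} {lift₀ (lift₀ L)} ((λ ()) ∷ []) proper₂ arrangement
    (lift-realize {K = map ⇑ K} {lift₀ L} (lift-realize {K = K} {L} (complete L)))
    (unlift₂ Λ Λ-fixes-0 Λ-fixes-1) (trans (sgn-id {suc (suc (suc (suc q)))}) (sym even))
  where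
  K : List (Edge (suc (suc q)))
  K = orderedPairs (suc (suc q))
  M far₀ far₁ far closing l₁ l₂ : List (Edge (suc (suc (suc (suc q)))))
  M = map ⇑ (map ⇑ K)
  far₀ = tabulate (λ j → 0F , suc (suc (suc (suc j))))
  far₁ = map ⇑ (tabulate (λ j → 0F , suc (suc (suc j))))
  far = far₀ ++ far₁
  closing = (1F , 2F) ∷ (0F , 3F) ∷ []
  l₁ = (0F , 1F) ∷ []
  l₂ = (0F , 2F) ∷ (1F , 3F) ∷ far ++ closing
  far-all : {P : Edge (suc (suc (suc (suc q)))) → Set} →
    (∀ j → P (0F , suc (suc (suc (suc j))))) → (∀ j → P (1F , suc (suc (suc (suc j))))) →
    All P far
  far-all at-0 at-1 = ++⁺ (tabulate⁺ at-0) (map⁺ (tabulate⁺ at-1))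
  proper₂ : All Proper l₂
  proper₂ = (λ ()) ∷ (λ ()) ∷ ++⁺ (far-all (λ _ ()) (λ _ ())) ((λ ()) ∷ (λ ()) ∷ [])
  far-avoids-2 : All (Avoids 2F) far
  far-avoids-2 = far-all (λ _ → (λ ()) , (λ ())) (λ _ → (λ ()) , (λ ()))
  far-avoids-3 : All (Avoids 3F) far
  far-avoids-3 = far-all (λ _ → (λ ()) , (λ ())) (λ _ → (λ ()) , (λ ()))
  -- 0 ↦ 2 ↦ 2 ↦ 1 and 1 ↦ 3 ↦ 3 ↦ 0, so that l₂ undoes the transposition (0 1) of l₁
  l₂-0 : prod l₂ ⟨$⟩ʳ 0F ≡ 1F
  l₂-0 = trans (prod-++ far closing 2F) (cong (prod closing ⟨$⟩ʳ_) (prod-fixes far far-avoids-2))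
  l₂-1 : prod l₂ ⟨$⟩ʳ 1F ≡ 0F
  l₂-1 = trans (prod-++ far closing 3F) (cong (prod closing ⟨$⟩ʳ_) (prod-fixes far far-avoids-3))
  Λ : Permutation′ (suc (suc (suc (suc q))))
  Λ = flip (prod l₁) ∘ₚ id ∘ₚ flip (prod l₂)
  L : Permutation′ (suc (suc q))
  L = remove 0F (remove 0F Λ)
  Λ-fixes-0 : Λ ⟨$⟩ʳ 0F ≡ 0F
  Λ-fixes-0 = trans (cong (prod l₂ ⟨$⟩ˡ_) (sym l₂-0)) (inverseˡ (prod l₂))
  Λ-fixes-1 : Λ ⟨$⟩ʳ 1F ≡ 1F
  Λ-fixes-1 = trans (cong (prod l₂ ⟨$⟩ˡ_) (sym l₂-1)) (inverseˡ (prod l₂))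
  edges : orderedPairs (suc (suc (suc (suc q))))
        ≡ (0F , 1F) ∷ (0F , 2F) ∷ (0F , 3F) ∷ far₀ ++ (1F , 2F) ∷ (1F , 3F) ∷ far₁ ++ M
  edges = trans (orderedPairs-suc (suc (suc (suc q))))
    (cong (spokes (suc (suc (suc q))) ++_)
      (trans (cong (map ⇑) (orderedPairs-suc (suc (suc q))))
             (map-++ ⇑ (spokes (suc (suc q))) (map ⇑ K))))
  open CommutativeMonoidSolver (++-commutativeMonoid {A = Edge (suc (suc (suc (suc q))))})
    using (solve; _⊕_; _⊜_)
  arrangement : l₁ ++ M ++ l₂ ↭ orderedPairs (suc (suc (suc (suc q))))
  arrangement = ↭-trans
    (solve 8 (λ e₀₁ e₀₂ e₀₃ f₀ e₁₂ e₁₃ f₁ m →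
        e₀₁ ⊕ (m ⊕ (e₀₂ ⊕ (e₁₃ ⊕ ((f₀ ⊕ f₁) ⊕ (e₁₂ ⊕ e₀₃)))))
      ⊜ e₀₁ ⊕ (e₀₂ ⊕ (e₀₃ ⊕ (f₀ ⊕ (e₁₂ ⊕ (e₁₃ ⊕ (f₁ ⊕ m)))))))
      ↭-refl [ 0F , 1F ] [ 0F , 2F ] [ 0F , 3F ] far₀ [ 1F , 2F ] [ 1F , 3F ] far₁ M)
    (↭-reflexive (sym edges))

-- The identity on 2 + k points; for k < 2 the edge count (1 or 3) is odd.
identity-realizable : ∀ k → Complete k →
  parity (length (orderedPairs (suc (suc k)))) ≡ 0ℙ →
  InProd (orderedPairs (suc (suc k))) id
identity-realizable zero          _        ()
identity-realizable (suc zero)    _        ()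
identity-realizable (suc (suc q)) complete even = identity-realized q complete even

-- If π moves 0 to w + 1, peel vertex 0 with all spokes in the suffix, w first.
peel-moved-zero : ∀ {n} → Complete n → (π : Permutation′ (suc n)) →
  sgn π ≡ parity (length (orderedPairs (suc n))) →
  ∀ w → π ⟨$⟩ʳ 0F ≡ suc w → InProd (orderedPairs (suc n)) π
peel-moved-zero {n} complete π even w π-0 with extract (∈-allFin w) (allFin⁺ n)
... | R , w∷R↭ , w∉R , _ = peel-vertex complete π even [] w R w∷R↭ w∉R π-0

-- If π fixes 0 but sends y + 1 to v + 1 ≠ y + 1, peel with the prefix [y] and v first
-- in the suffix.
peel-moved-suc : ∀ {n} → Complete n → (π : Permutation′ (suc n)) →
  sgn π ≡ parity (length (orderedPairs (suc n))) →
  π ⟨$⟩ʳ 0F ≡ 0F → ∀ y → π ⟨$⟩ʳ suc y ≢ suc y → InProd (orderedPairs (suc n)) π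
peel-moved-suc {n} complete π even π-0 y moved = by-image (π ⟨$⟩ʳ suc y) refl
  where
  by-image : ∀ x → π ⟨$⟩ʳ suc y ≡ x → InProd (orderedPairs (suc n)) π
  by-image zero    π-y = ⊥-elim (0≢y+1 (permute-injective π (trans π-0 (sym π-y))))
    where
    0≢y+1 : 0F ≢ suc y
    0≢y+1 ()
  by-image (suc v) π-y with extract (∈-allFin y) (allFin⁺ n)
  ... | R₁ , y∷R₁↭ , _ , unique₁ with ∈-resp-↭ (↭-sym y∷R₁↭) (∈-allFin v)
  ...   | here v≡y   = ⊥-elim (moved (trans π-y (cong suc v≡y)))
  ...   | there v∈R₁ with extract v∈R₁ unique₁
  ...     | R₂ , v∷R₂↭ , v∉R₂ , _ =
    peel-vertex complete π even [ y ] v R₂ (↭-trans (↭-prep y v∷R₂↭) y∷R₁↭) v∉R₂ π-y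

step : ∀ {k} → Complete k → Complete (suc k) → Complete (suc (suc k))
step {k} complete₀ complete₁ π even = by-image-of-0 (π ⟨$⟩ʳ 0F) refl
  where
  by-image-of-0 : ∀ x → π ⟨$⟩ʳ 0F ≡ x → InProd (orderedPairs (suc (suc k))) π
  by-image-of-0 (suc w) π-0 = peel-moved-zero complete₁ π even w π-0
  by-image-of-0 zero    π-0 with any? (λ y → ¬? (π ⟨$⟩ʳ suc y ≟ suc y))
  ... | yes (y , moved) = peel-moved-suc complete₁ π even π-0 y moved
  ... | no  none-moved  = inProd-resp-≈ {π = id} {π} (λ i → sym (π≈id i))
    (identity-realizable k complete₀ (trans (sym even) (trans (sgn-cong {π = π} {id} π≈id) (sgn-id {suc (suc k)}))))
    where
    π≈id : π ≈ id
    π≈id zero    = π-0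
    π≈id (suc y) with π ⟨$⟩ʳ suc y ≟ suc y
    ... | yes fixed = fixed
    ... | no  moved = ⊥-elim (none-moved (y , moved))

complete : ∀ n → Complete n
complete zero          π _ = [] , ↭-refl , λ ()
complete (suc zero)    π _ = [] , ↭-refl , λ { zero → only-point (π ⟨$⟩ʳ zero) }
  where
  only-point : (i : Fin 1) → 0F ≡ i
  only-point zero = refl
complete (suc (suc k)) = step (complete k) (complete (suc k))

characterization : ∀ n {p} → parity (length (orderedPairs n)) ≡ p →
  (π : Permutation′ n) → InProd (orderedPairs n) π ⇔ (sgn π ≡ p)
characterization n refl π = mk⇔ (sgn-sound {π = π} (proper-orderedPairs n)) (complete n π)

parity≡0⇒even : ∀ m → parity m ≡ 0ℙ → m % 2 ≡ 0
parity≡0⇒even zero          _ = refl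
parity≡0⇒even (suc zero)    ()
parity≡0⇒even (suc (suc m)) p = parity≡0⇒even m p

even⇒parity≡0 : ∀ m → m % 2 ≡ 0 → parity m ≡ 0ℙ
even⇒parity≡0 zero          _ = refl
even⇒parity≡0 (suc zero)    ()
even⇒parity≡0 (suc (suc m)) e = even⇒parity≡0 m e

even⇔sgn≡0ℙ : ∀ {n} (π : Permutation′ n) → (sgn π ≡ 0ℙ) ⇔ IsEven π
even⇔sgn≡0ℙ π = mk⇔ (parity≡0⇒even (inversions π)) (even⇒parity≡0 (inversions π))

odd⇔sgn≡1ℙ : ∀ {n} (π : Permutation′ n) → (sgn π ≡ 1ℙ) ⇔ (¬ IsEven π)
odd⇔sgn≡1ℙ π = mk⇔ (λ odd even → 1ℙ≢0ℙ (trans (sym odd) (even⇒parity≡0 (inversions π) even)))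
                   (λ ¬even → not-even (sgn π) refl ¬even)
  where
  1ℙ≢0ℙ : 1ℙ ≢ 0ℙ
  1ℙ≢0ℙ ()
  not-even : ∀ p → sgn π ≡ p → ¬ IsEven π → sgn π ≡ 1ℙ
  not-even 0ℙ s ¬even = ⊥-elim (¬even (parity≡0⇒even (inversions π) s))
  not-even 1ℙ s _     = s

corollary2p13 : (n : ℕ) →
    ((π : Permutation′ n) → InProd (completeGraphEdges n) π ⇔ IsEven π)
    ⊎ ((π : Permutation′ n) → InProd (completeGraphEdges n) π ⇔ (¬ IsEven π))
corollary2p13 n with parity (length (completeGraphEdges n)) in edges
... | 0ℙ = inj₁ λ π → even⇔sgn≡0ℙ π ⇔-∘ characterization n edges π
... | 1ℙ = inj₂ λ π → odd⇔sgn≡1ℙ π ⇔-∘ characterization n edges π
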